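{- Let $\mathcal H_{\mathbb Z_{\le 0}}\subseteq\mathcal H_{\mathbb Z}$ be the span of $\mathbf 1$ together with all $[s_1,\dots,s_k]$ ($k\ge1$) having all $s_i\le 0$. Then $(\mathcal H_{\mathbb Z_{\le0}},\sqcup\!\sqcup,J)$ is a differential subalgebra of $(\mathcal H_{\mathbb Z},\sqcup\!\sqcup,J)$. That is, $\mathcal H_{\mathbb Z_{\le0}}$ is closed under $\sqcup\!\sqcup$ and under $J$.
   Context: Let $\mathcal H_{\mathbb Z}$ be the $\mathbb Q$-vector space with basis $\mathbf 1$ together with the formal symbols $[s_1,\dots,s_k]$ for $k\ge1$ and $(s_1,\dots,s_k)\in\mathbb Z^k$. Define linear maps on basis elements of positive depth by $I([s_1,s_2,\dots,s_k])=[s_1+1,s_2,\dots,s_k]$ and $J([s_1,s_2,\dots,s_k])=[s_1-1,s_2,\dots,s_k]$, and set $J(\mathbf 1)=0$. $J$ is a derivation of $\sqcup\!\sqcup$. Notation: for a positive-depth basis element, write $[s_1,\dots,s_k]=[s_1,\vec s\,']$, where $[\vec s\,']=[s_2,\dots,s_k]$, or $\mathbf 1$ if $k=1$. For $a\in\mathbb Z$ and $X=\sum c_{\vec v}[\vec v]$, put $[a,X]:=\sum c_{\vec v}[a,\vec v]$, with $[a,\mathbf 1]:=[a]$. The extended shuffle product $\sqcup\!\sqcup$ is the bilinear product with two-sided unit $\mathbf 1$, defined on positive-depth basis elements by the following recursions: <ul> <li>(i) if $s_1=0$: $[0,\vec s\,']\sqcup\!\sqcup[t_1,\vec t\,']=[0,[\vec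 s\,']\sqcup\!\sqcup[t_1,\vec t\,']]$;</li> <li>(ii) if $s_1>0$ and $t_1=0$: $[s_1,\vec s\,']\sqcup\!\sqcup[0,\vec t\,']=[0,[s_1,\vec s\,']\sqcup\!\sqcup[\vec t\,']]$;</li> <li>(iii) if $s_1,t_1>0$: $[s_1,\vec s\,']\sqcup\!\sqcup[t_1,\vec t\,']=I([s_1,\vec s\,']\sqcup\!\sqcup[t_1-1,\vec t\,'])+I([s_1-1,\vec s\,']\sqcup\!\sqcup[t_1,\vec t\,'])$;</li> <li>(iv) if $s_1>0$ and $t_1<0$: $[s_1,\vec s\,']\sqcup\!\sqcup[t_1,\vec t\,']=J([s_1,\vec s\,']\sqcup\!\sqcup[t_1+1,\vec t\,'])-[s_1-1,\vec s\,']\sqcup\!\sqcup[t_1+1,\vec t\,']$;</li> <li>(v) if $s_1<0$: $[s_1,\vec s\,']\sqcup\!\sqcup[t_1,\vec t\,']=J([s_1+1,\vec s\,']\sqcup\!\sqcup[t_1,\vec t\,'])-[s_1+1,\vec s\,']\sqcup\!\sqcup[t_1-1,\vec t\,']$.</li> </ul> The recursions are well founded: (i) and (ii) by induction on total depth, (iii) on $s_1+t_1$, (iv) on $|t_1|$, and (v) on $|s_1|$. -}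

module Defs where

open import Data.Nat using (ℕ; zero; suc)
open import Data.Integer as ℤ using (ℤ; +_; -[1+_]; _<_)
open import Data.Rational as ℚ using (ℚ; 0ℚ; 1ℚ)
open import Data.List using (List; []; _∷_; map; concatMap; _++_)
open import Data.List.Properties using (≡-dec)
open import Data.List.Relation.Unary.Any using (Any)
open import Data.Product using (_×_; _,_)
open import Relation.Nullary using (yes; no)
open import Relation.Binary.PropositionalEquality using (_≡_)

-- A basis word: [] stands for the unit 𝟏, (s₁ ∷ … ∷ sₖ ∷ []) for [s₁,…,sₖ].
Word : Set
Word = List ℤ

-- An element of ℋ_ℤ : a finite formal ℚ-linear combination of basis words.
-- Two such lists denote the same vector iff all their coefficients agree.
H : Set
H = List (ℚ × Word)

coeff : Word → H → ℚ
coeff w [] = 0ℚ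
coeff w ((c , v) ∷ X) with ≡-dec ℤ._≟_ v w
... | yes _ = c ℚ.+ coeff w X
... | no _  = coeff w X

unit : H
unit = (1ℚ , []) ∷ []

basis : Word → H
basis w = (1ℚ , w) ∷ []

scale : ℚ → H → H
scale a = map (λ { (c , v) → (a ℚ.* c , v) })

_⊕_ : H → H → H
X ⊕ Y = X ++ Y

_⊖_ : H → H → H
X ⊖ Y = X ++ scale (ℚ.- 1ℚ) Y

-- the map X ↦ [0, X]  (with [0, 𝟏] = [0])
cons0 : H → H
cons0 = map (λ { (c , v) → (c , (+ 0) ∷ v) })

-- I and J on basis words; J(𝟏) = 0.  I is only ever applied to combinations
-- of positive-depth words (I(𝟏) is not defined in the paper; we send it to 0).
Iw : ℚ × Word → H
Iw (c , []) = []
Iw (c , s ∷ v) = (c , (s ℤ.+ + 1) ∷ v) ∷ []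

Jw : ℚ × Word → H
Jw (c , []) = []
Jw (c , s ∷ v) = (c , (s ℤ.- + 1) ∷ v) ∷ []

I : H → H
I = concatMap Iw

J : H → H
J = concatMap Jw

-- The extended shuffle product on basis words, following recursions (i)–(v).
-- shh x s' y t' = [x, s'] ⧢ [y, t'].  The helper functions split by the
-- signs of the first letters so that Agda sees termination:
--   zeroL s' y t'   = [0, s'] ⧢ [y, t']                         (rule (i))
--   caseII m s' t'  = [m+1, s'] ⧢ [0, t']                       (rule (ii))
--   pp m n s' t'    = [m+1, s'] ⧢ [n+1, t']                     (rule (iii))
--   pn m n s' t'    = [m+1, s'] ⧢ [-(n+1), t']                  (rule (iv))
--   neg m s' y t'   = [-(m+1), s'] ⧢ [y, t']                    (rule (v))
--   shW s' y t'     = [s'] ⧢ [y, t']   (s' may be empty, i.e. 𝟏)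
--   shW2 x s' t'    = [x, s'] ⧢ [t']   (t' may be empty, i.e. 𝟏)
mutual
  shh : ℤ → Word → ℤ → Word → H
  shh (+ zero)  s' y t' = zeroL s' y t'
  shh (+ suc m) s' y t' = posL m s' y t'
  shh -[1+ m ]  s' y t' = neg m s' y t'

  shW : Word → ℤ → Word → H
  shW [] y t' = basis (y ∷ t')
  shW (a ∷ s'') y t' = shh a s'' y t'

  shW2 : ℤ → Word → Word → H
  shW2 x s' [] = basis (x ∷ s')
  shW2 x s' (b ∷ t'') = shh x s' b t''

  zeroL : Word → ℤ → Word → H
  zeroL s' y t' = cons0 (shW s' y t')

  caseII : ℕ → Word → Word → H
  caseII m s' t' = cons0 (shW2 (+ suc m) s' t')

  posL : ℕ → Word → ℤ → Word → H
  posL m s' (+ zero)  t' = caseII m s' t'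
  posL m s' (+ suc n) t' = pp m n s' t'
  posL m s' -[1+ n ]  t' = pn m n s' t'

  -- (iii): I([s₁,s'] ⧢ [t₁-1,t']) + I([s₁-1,s'] ⧢ [t₁,t'])
  pp : ℕ → ℕ → Word → Word → H
  pp m zero    s' t' = I (caseII m s' t') ⊕ I (ppSecond m zero s' t')
  pp m (suc n) s' t' = I (pp m n s' t') ⊕ I (ppSecond m (suc n) s' t')

  -- [m, s'] ⧢ [n+1, t']
  ppSecond : ℕ → ℕ → Word → Word → H
  ppSecond zero    n s' t' = zeroL s' (+ suc n) t'
  ppSecond (suc m) n s' t' = pp m n s' t'

  -- (iv): J([s₁,s'] ⧢ [t₁+1,t']) − [s₁-1,s'] ⧢ [t₁+1,t']
  pn : ℕ → ℕ → Word → Word → H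
  pn m zero    s' t' = J (caseII m s' t') ⊖ pnSecond m zero s' t'
  pn m (suc n) s' t' = J (pn m n s' t') ⊖ pnSecond m (suc n) s' t'

  -- [m, s'] ⧢ [-(n+1)+1, t']
  pnSecond : ℕ → ℕ → Word → Word → H
  pnSecond zero    n       s' t' = zeroL s' (-[1+ n ] ℤ.+ + 1) t'
  pnSecond (suc m) zero    s' t' = caseII m s' t'
  pnSecond (suc m) (suc n) s' t' = pn m n s' t'

  -- (v): J([s₁+1,s'] ⧢ [t₁,t']) − [s₁+1,s'] ⧢ [t₁-1,t']
  neg : ℕ → Word → ℤ → Word → H
  neg zero    s' y t' = J (zeroL s' y t') ⊖ zeroL s' (y ℤ.- + 1) t'
  neg (suc m) s' y t' = J (neg m s' y t') ⊖ neg m s' (y ℤ.- + 1) t'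

shw : Word → Word → H
shw [] w = basis w
shw (a ∷ v) [] = basis (a ∷ v)
shw (a ∷ v) (b ∷ w) = shh a v b w

_⧢_ : H → H → H
X ⧢ Y = concatMap (λ { (c , v) → concatMap (λ { (d , w) → scale (c ℚ.* d) (shw v w) }) Y }) X

InHle0 : H → Set
InHle0 X = ∀ (w : Word) → Any (λ s → + 0 < s) w → coeff w X ≡ 0ℚ

{-# OPTIONS --safe #-}
module Submission where

-- Reading off a coefficient is linear, so the coefficient of w in X ⧢ Y is a
-- bilinear expression in the coefficient functions of X and Y.  Hence ⧢
-- respects equality of coefficients, and an element of ℋ_{ℤ≤0} may be replaced
-- by the sublist of its terms on nonpositive words.  When both first letters
-- are ≤ 0 only rules (i) and (v) apply, and these, like J, never create a
-- positive letter.  For J itself, the coefficient of s ∷ v in J X is that of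
-- (s + 1) ∷ v in X, and raising a letter keeps it positive.

open import Defs
open import Data.Empty using (⊥-elim)
open import Data.Integer as ℤ using (+_; -[1+_]; +≤+)
import Data.Integer.Properties as ℤP
open import Algebra.Properties.AbelianGroup ℤP.+-0-abelianGroup
  using (//-rightDividesˡ; //-rightDividesʳ)
open import Data.List using ([]; _∷_; concatMap; _++_; length; filter)
open import Data.List.Properties using (≡-dec; ∷-injective; filter-notAll)
open import Data.List.Relation.Unary.All as All using (All; []; _∷_; all?)
open import Data.List.Relation.Unary.All.Properties
  using (++⁺; map⁺; concat⁺; all-filter; All¬⇒¬Any; ¬Any⇒All¬)
open import Data.List.Relation.Unary.Any using (Any; here; there; any?)
open import Data.Nat as ℕ using (zero; suc; z≤n)
open import Data.Nat.Induction using (<-wellFounded)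
open import Data.Product using (_×_; _,_; proj₂)
open import Data.Rational as ℚ using (ℚ; 0ℚ; 1ℚ)
import Data.Rational.Properties as ℚP
open import Data.Rational.Solver using (module +-*-Solver)
open import Function using (_∘_)
open import Induction.WellFounded using (Acc; acc)
open import Level using (0ℓ)
open import Relation.Binary.PropositionalEquality
  using (_≡_; refl; sym; trans; cong; cong₂; module ≡-Reasoning)
open import Relation.Nullary using (¬_; yes; no; ¬?)
open import Relation.Binary using () renaming (Decidable to Decidable₂)
open import Relation.Unary using (Pred; Decidable)

open +-*-Solver
open ≡-Reasoning

infix 4 _≈_

record _≈_ (X Y : H) : Set where
  constructor mk≈
  field coeffwise : ∀ w → coeff w X ≡ coeff w Y

open _≈_

coeff-++ : ∀ w X Y → coeff w (X ++ Y) ≡ coeff w X ℚ.+ coeff w Y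
coeff-++ w [] Y = sym (ℚP.+-identityˡ _)
coeff-++ w ((c , v) ∷ X) Y with ≡-dec ℤ._≟_ v w
... | yes _ = trans (cong (c ℚ.+_) (coeff-++ w X Y)) (sym (ℚP.+-assoc c _ _))
... | no _  = coeff-++ w X Y

coeff-scale : ∀ w a X → coeff w (scale a X) ≡ a ℚ.* coeff w X
coeff-scale w a [] = sym (ℚP.*-zeroʳ a)
coeff-scale w a ((c , v) ∷ X) with ≡-dec ℤ._≟_ v w
... | yes _ = trans (cong (a ℚ.* c ℚ.+_) (coeff-scale w a X)) (sym (ℚP.*-distribˡ-+ a c _))
... | no _  = coeff-scale w a X

restrict : {P : Pred Word 0ℓ} → Decidable P → H → H
restrict P? = filter (P? ∘ proj₂)

coeff-restrict : ∀ {P : Pred Word 0ℓ} (P? : Decidable P) {w} → P w →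
                 ∀ X → coeff w (restrict P? X) ≡ coeff w X
coeff-restrict P? Pw [] = refl
coeff-restrict P? {w} Pw ((c , v) ∷ X) with P? v
... | yes _ with ≡-dec ℤ._≟_ v w
...   | yes _ = cong (c ℚ.+_) (coeff-restrict P? Pw X)
...   | no _  = coeff-restrict P? Pw X
coeff-restrict P? {w} Pw ((c , v) ∷ X) | no ¬Pv with ≡-dec ℤ._≟_ v w
...   | yes refl = ⊥-elim (¬Pv Pw)
...   | no _     = coeff-restrict P? Pw X

coeff-outside : ∀ {P : Pred Word 0ℓ} {w} → ¬ P w → ∀ {X} → All (P ∘ proj₂) X → coeff w X ≡ 0ℚ
coeff-outside ¬Pw [] = refl
coeff-outside {w = w} ¬Pw {(c , v) ∷ X} (Pv ∷ PX) with ≡-dec ℤ._≟_ v w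
... | yes refl = ⊥-elim (¬Pw Pv)
... | no _     = coeff-outside ¬Pw PX

extend : (Word → ℚ) → H → ℚ
extend g [] = 0ℚ
extend g ((c , v) ∷ X) = c ℚ.* g v ℚ.+ extend g X

extend-++ : ∀ g X Y → extend g (X ++ Y) ≡ extend g X ℚ.+ extend g Y
extend-++ g [] Y = sym (ℚP.+-identityˡ _)
extend-++ g ((c , v) ∷ X) Y =
  trans (cong (c ℚ.* g v ℚ.+_) (extend-++ g X Y)) (sym (ℚP.+-assoc (c ℚ.* g v) _ _))

extend-scale : ∀ g a X → extend g (scale a X) ≡ a ℚ.* extend g X
extend-scale g a [] = sym (ℚP.*-zeroʳ a)
extend-scale g a ((c , v) ∷ X) =
  trans (cong₂ ℚ._+_ (ℚP.*-assoc a c (g v)) (extend-scale g a X)) (sym (ℚP.*-distribˡ-+ a _ _))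

extend-scaleˡ : ∀ a g X → extend (λ v → a ℚ.* g v) X ≡ a ℚ.* extend g X
extend-scaleˡ a g [] = sym (ℚP.*-zeroʳ a)
extend-scaleˡ a g ((c , v) ∷ X) =
  trans (cong₂ ℚ._+_ (solve 3 (λ a c x → c :* (a :* x) := a :* (c :* x)) refl a c (g v))
                     (extend-scaleˡ a g X))
        (sym (ℚP.*-distribˡ-+ a _ _))

extend-congˡ : ∀ {f g} → (∀ v → f v ≡ g v) → ∀ X → extend f X ≡ extend g X
extend-congˡ f≗g [] = refl
extend-congˡ f≗g ((c , v) ∷ X) = cong₂ (λ a b → c ℚ.* a ℚ.+ b) (f≗g v) (extend-congˡ f≗g X)

coeff-concatMap : ∀ w (f : ℚ × Word → H) (g : Word → ℚ) →
                  (∀ c v → coeff w (f (c , v)) ≡ c ℚ.* g v) →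
                  ∀ X → coeff w (concatMap f X) ≡ extend g X
coeff-concatMap w f g hf [] = refl
coeff-concatMap w f g hf ((c , v) ∷ X) =
  trans (coeff-++ w (f (c , v)) (concatMap f X)) (cong₂ ℚ._+_ (hf c v) (coeff-concatMap w f g hf X))

coeff-⧢ : ∀ w X Y → coeff w (X ⧢ Y) ≡ extend (λ v → extend (λ u → coeff w (shw v u)) Y) X
coeff-⧢ w X Y = coeff-concatMap w _ _ coeff-row X
  where
  coeff-row : ∀ c v → coeff w (concatMap (λ { (d , u) → scale (c ℚ.* d) (shw v u) }) Y)
                      ≡ c ℚ.* extend (λ u → coeff w (shw v u)) Y
  coeff-row c v =
    trans (coeff-concatMap w _ (λ u → c ℚ.* coeff w (shw v u)) coeff-entry Y)
          (extend-scaleˡ c _ Y)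
    where
    coeff-entry : ∀ d u → coeff w (scale (c ℚ.* d) (shw v u)) ≡ d ℚ.* (c ℚ.* coeff w (shw v u))
    coeff-entry d u =
      trans (coeff-scale w (c ℚ.* d) (shw v u))
            (solve 3 (λ c d x → (c :* d) :* x := d :* (c :* x)) refl c d (coeff w (shw v u)))

_≢?_ : Decidable₂ {A = Word} (λ u v → ¬ u ≡ v)
u ≢? v = ¬? (≡-dec ℤ._≟_ u v)

remove : Word → H → H
remove v = restrict (_≢? v)

extend-remove : ∀ g v X → extend g X ≡ coeff v X ℚ.* g v ℚ.+ extend g (remove v X)
extend-remove g v [] = sym (trans (ℚP.+-identityʳ _) (ℚP.*-zeroˡ (g v)))
extend-remove g v ((c , u) ∷ X) with ≡-dec ℤ._≟_ u v
... | yes refl = trans (cong (c ℚ.* g u ℚ.+_) (extend-remove g u X))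
  (solve 4 (λ c k x r → c :* x :+ (k :* x :+ r) := (c :+ k) :* x :+ r) refl
         c (coeff u X) (g u) (extend g (remove u X)))
... | no _ = trans (cong (c ℚ.* g u ℚ.+_) (extend-remove g v X))
  (solve 4 (λ a k x r → a :+ (k :* x :+ r) := k :* x :+ (a :+ r)) refl
         (c ℚ.* g u) (coeff v X) (g v) (extend g (remove v X)))

remove-null : ∀ v {Z} → Z ≈ [] → remove v Z ≈ []
remove-null v {Z} Z≈0 = mk≈ null
  where
  null : ∀ w → coeff w (remove v Z) ≡ 0ℚ
  null w with ≡-dec ℤ._≟_ w v
  ... | yes refl = coeff-outside (λ w≢w → w≢w refl) (all-filter _ Z)
  ... | no w≢v   = trans (coeff-restrict _ w≢v Z) (coeffwise Z≈0 w)

-- The terms of Z may cancel each other, so all occurrences of one word are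
-- stripped off together, by well-founded recursion on the length.
extend-null : ∀ g {Z} → Z ≈ [] → extend g Z ≡ 0ℚ
extend-null g {Z} = go Z (<-wellFounded (length Z))
  where
  go : ∀ Z → Acc ℕ._<_ (length Z) → Z ≈ [] → extend g Z ≡ 0ℚ
  go [] _ _ = refl
  go Z@((c , v) ∷ _) (acc shorter) Z≈0 = begin
    extend g Z
      ≡⟨ extend-remove g v Z ⟩
    coeff v Z ℚ.* g v ℚ.+ extend g (remove v Z)
      ≡⟨ cong₂ (λ a b → a ℚ.* g v ℚ.+ b) (coeffwise Z≈0 v) ih ⟩
    0ℚ ℚ.* g v ℚ.+ 0ℚ
      ≡⟨ trans (ℚP.+-identityʳ _) (ℚP.*-zeroˡ (g v)) ⟩
    0ℚ
      ∎
    where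
    ih : extend g (remove v Z) ≡ 0ℚ
    ih = go (remove v Z) (shorter (filter-notAll ((_≢? v) ∘ proj₂) Z (here (λ v≢v → v≢v refl))))
            (remove-null v Z≈0)

extend-congʳ : ∀ g {X Y} → X ≈ Y → extend g X ≡ extend g Y
extend-congʳ g {X} {Y} X≈Y = begin
  extend g X
    ≡⟨ solve 2 (λ a b → a := a :+ con −1 :* b :+ b) refl (extend g X) (extend g Y) ⟩
  extend g X ℚ.+ −1 ℚ.* extend g Y ℚ.+ extend g Y
    ≡⟨ cong (ℚ._+ extend g Y) extend-⊖ ⟨
  extend g (X ⊖ Y) ℚ.+ extend g Y
    ≡⟨ cong (ℚ._+ extend g Y) (extend-null g ⊖-null) ⟩
  0ℚ ℚ.+ extend g Y
    ≡⟨ ℚP.+-identityˡ _ ⟩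
  extend g Y
    ∎
  where
  −1 : ℚ
  −1 = ℚ.- 1ℚ
  extend-⊖ : extend g (X ⊖ Y) ≡ extend g X ℚ.+ −1 ℚ.* extend g Y
  extend-⊖ = trans (extend-++ g X _) (cong (extend g X ℚ.+_) (extend-scale g −1 Y))
  ⊖-null : X ⊖ Y ≈ []
  ⊖-null = mk≈ λ w → begin
    coeff w (X ⊖ Y)
      ≡⟨ coeff-++ w X _ ⟩
    coeff w X ℚ.+ coeff w (scale −1 Y)
      ≡⟨ cong₂ ℚ._+_ (coeffwise X≈Y w) (coeff-scale w −1 Y) ⟩
    coeff w Y ℚ.+ −1 ℚ.* coeff w Y
      ≡⟨ solve 1 (λ a → a :+ con −1 :* a := con 0ℚ) refl (coeff w Y) ⟩
    0ℚ
      ∎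

⧢-cong : ∀ {X X' Y Y'} → X ≈ X' → Y ≈ Y' → X ⧢ Y ≈ X' ⧢ Y'
⧢-cong {X} {X'} {Y} {Y'} X≈X' Y≈Y' = mk≈ λ w → let c v u = coeff w (shw v u) in begin
  coeff w (X ⧢ Y)                     ≡⟨ coeff-⧢ w X Y ⟩
  extend (λ v → extend (c v) Y) X     ≡⟨ extend-congʳ _ X≈X' ⟩
  extend (λ v → extend (c v) Y) X'    ≡⟨ extend-congˡ (λ v → extend-congʳ (c v) Y≈Y') X' ⟩
  extend (λ v → extend (c v) Y') X'   ≡⟨ coeff-⧢ w X' Y' ⟨
  coeff w (X' ⧢ Y')                   ∎

NonpositiveWord : Pred Word 0ℓ
NonpositiveWord = All (ℤ._≤ + 0)

nonpositiveWord? : Decidable NonpositiveWord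
nonpositiveWord? = all? (ℤ._≤? + 0)

HasPositiveLetter : Pred Word 0ℓ
HasPositiveLetter = Any (+ 0 ℤ.<_)

nonpositiveWord⇒¬hasPositiveLetter : ∀ {w} → NonpositiveWord w → ¬ HasPositiveLetter w
nonpositiveWord⇒¬hasPositiveLetter = All¬⇒¬Any ∘ All.map ℤP.≤⇒≯

¬hasPositiveLetter⇒nonpositiveWord : ∀ {w} → ¬ HasPositiveLetter w → NonpositiveWord w
¬hasPositiveLetter⇒nonpositiveWord = All.map ℤP.≮⇒≥ ∘ ¬Any⇒All¬ _

decrementHead-nonpositive : ∀ {y t} → NonpositiveWord (y ∷ t) → NonpositiveWord ((y ℤ.- + 1) ∷ t)
decrementHead-nonpositive (y≤0 ∷ t≤0) = ℤP.i≤j⇒i-k≤j (+ 1) y≤0 ∷ t≤0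

Nonpositive : H → Set
Nonpositive = All (NonpositiveWord ∘ proj₂)

Nonpositive⇒InHle0 : ∀ {X} → Nonpositive X → InHle0 X
Nonpositive⇒InHle0 X≤0 w w>0 = coeff-outside (λ w≤0 → nonpositiveWord⇒¬hasPositiveLetter w≤0 w>0) X≤0

InHle0-resp-≈ : ∀ {X Y} → X ≈ Y → InHle0 Y → InHle0 X
InHle0-resp-≈ X≈Y Y∈ w w>0 = trans (coeffwise X≈Y w) (Y∈ w w>0)

nonpositivePart : H → H
nonpositivePart = restrict nonpositiveWord?

nonpositivePart-nonpositive : ∀ X → Nonpositive (nonpositivePart X)
nonpositivePart-nonpositive = all-filter _

InHle0⇒≈nonpositivePart : ∀ X → InHle0 X → X ≈ nonpositivePart X
InHle0⇒≈nonpositivePart X X∈ = mk≈ agree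
  where
  agree : ∀ w → coeff w X ≡ coeff w (nonpositivePart X)
  agree w with any? (+ 0 ℤP.<?_) w
  ... | yes w>0 = trans (X∈ w w>0) (sym (Nonpositive⇒InHle0 (nonpositivePart-nonpositive X) w w>0))
  ... | no ¬w>0 = sym (coeff-restrict nonpositiveWord? (¬hasPositiveLetter⇒nonpositiveWord ¬w>0) X)

Nonpositive-concatMap : ∀ {f : ℚ × Word → H} →
                        (∀ {t} → NonpositiveWord (proj₂ t) → Nonpositive (f t)) →
                        ∀ {X} → Nonpositive X → Nonpositive (concatMap f X)
Nonpositive-concatMap f≤0 X≤0 = concat⁺ (map⁺ (All.map f≤0 X≤0))

Nonpositive-scale : ∀ a {X} → Nonpositive X → Nonpositive (scale a X)
Nonpositive-scale a X≤0 = map⁺ X≤0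

Nonpositive-cons0 : ∀ {X} → Nonpositive X → Nonpositive (cons0 X)
Nonpositive-cons0 X≤0 = map⁺ (All.map (+≤+ z≤n ∷_) X≤0)

Nonpositive-⊖ : ∀ {X Y} → Nonpositive X → Nonpositive Y → Nonpositive (X ⊖ Y)
Nonpositive-⊖ X≤0 Y≤0 = ++⁺ X≤0 (Nonpositive-scale (ℚ.- 1ℚ) Y≤0)

Nonpositive-J : ∀ {X} → Nonpositive X → Nonpositive (J X)
Nonpositive-J = Nonpositive-concatMap Jw-nonpositive
  where
  Jw-nonpositive : ∀ {t} → NonpositiveWord (proj₂ t) → Nonpositive (Jw t)
  Jw-nonpositive {c , []} [] = []
  Jw-nonpositive {c , _ ∷ _} v≤0 = decrementHead-nonpositive v≤0 ∷ []

mutual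
  shh-nonpositive : ∀ a s y t → NonpositiveWord (a ∷ s) → NonpositiveWord (y ∷ t) →
                    Nonpositive (shh a s y t)
  shh-nonpositive (+ zero)  s y t (_ ∷ s≤0) yt≤0 = zeroL-nonpositive s y t s≤0 yt≤0
  shh-nonpositive (+ suc m) s y t (+≤+ () ∷ _) _
  shh-nonpositive -[1+ m ]  s y t (_ ∷ s≤0) yt≤0 = neg-nonpositive m s y t s≤0 yt≤0

  shW-nonpositive : ∀ s y t → NonpositiveWord s → NonpositiveWord (y ∷ t) → Nonpositive (shW s y t)
  shW-nonpositive []      y t _ yt≤0 = yt≤0 ∷ []
  shW-nonpositive (a ∷ s) y t as≤0 yt≤0 = shh-nonpositive a s y t as≤0 yt≤0

  zeroL-nonpositive : ∀ s y t → NonpositiveWord s → NonpositiveWord (y ∷ t) → Nonpositive (zeroL s y t)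
  zeroL-nonpositive s y t s≤0 yt≤0 = Nonpositive-cons0 (shW-nonpositive s y t s≤0 yt≤0)

  neg-nonpositive : ∀ m s y t → NonpositiveWord s → NonpositiveWord (y ∷ t) → Nonpositive (neg m s y t)
  neg-nonpositive zero s y t s≤0 yt≤0 =
    Nonpositive-⊖ (Nonpositive-J (zeroL-nonpositive s y t s≤0 yt≤0))
                  (zeroL-nonpositive s (y ℤ.- + 1) t s≤0 (decrementHead-nonpositive yt≤0))
  neg-nonpositive (suc m) s y t s≤0 yt≤0 =
    Nonpositive-⊖ (Nonpositive-J (neg-nonpositive m s y t s≤0 yt≤0))
                  (neg-nonpositive m s (y ℤ.- + 1) t s≤0 (decrementHead-nonpositive yt≤0))

shw-nonpositive : ∀ v u → NonpositiveWord v → NonpositiveWord u → Nonpositive (shw v u)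
shw-nonpositive []      u       _    u≤0  = u≤0 ∷ []
shw-nonpositive (a ∷ v) []      av≤0 _    = av≤0 ∷ []
shw-nonpositive (a ∷ v) (b ∷ u) av≤0 bu≤0 = shh-nonpositive a v b u av≤0 bu≤0

⧢-nonpositive : ∀ {X Y} → Nonpositive X → Nonpositive Y → Nonpositive (X ⧢ Y)
⧢-nonpositive X≤0 Y≤0 = Nonpositive-concatMap
  (λ { {c , v} v≤0 → Nonpositive-concatMap
          (λ { {d , u} u≤0 → Nonpositive-scale (c ℚ.* d) (shw-nonpositive v u v≤0 u≤0) }) Y≤0 })
  X≤0

⧢-InHle0 : ∀ X Y → InHle0 X → InHle0 Y → InHle0 (X ⧢ Y)
⧢-InHle0 X Y X∈ Y∈ =
  InHle0-resp-≈ (⧢-cong (InHle0⇒≈nonpositivePart X X∈) (InHle0⇒≈nonpositivePart Y Y∈))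
    (Nonpositive⇒InHle0
      (⧢-nonpositive (nonpositivePart-nonpositive X) (nonpositivePart-nonpositive Y)))

coeff-J : ∀ s v X → coeff (s ∷ v) (J X) ≡ coeff ((s ℤ.+ + 1) ∷ v) X
coeff-J s v [] = refl
coeff-J s v ((c , []) ∷ X) = coeff-J s v X
coeff-J s v ((c , a ∷ u) ∷ X)
  with ≡-dec ℤ._≟_ ((a ℤ.- + 1) ∷ u) (s ∷ v) | ≡-dec ℤ._≟_ (a ∷ u) ((s ℤ.+ + 1) ∷ v)
... | yes _  | yes _  = cong (c ℚ.+_) (coeff-J s v X)
... | no _   | no _   = coeff-J s v X
... | yes eq | no ¬eq = ⊥-elim (¬eq (raise eq))
  where
  raise : (a ℤ.- + 1) ∷ u ≡ s ∷ v → a ∷ u ≡ (s ℤ.+ + 1) ∷ v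
  raise eq with ∷-injective eq
  ... | refl , refl = cong (_∷ u) (sym (//-rightDividesˡ (+ 1) a))
... | no ¬eq | yes eq = ⊥-elim (¬eq (lower eq))
  where
  lower : a ∷ u ≡ (s ℤ.+ + 1) ∷ v → (a ℤ.- + 1) ∷ u ≡ s ∷ v
  lower eq with ∷-injective eq
  ... | refl , refl = cong (_∷ u) (//-rightDividesʳ (+ 1) s)

J-InHle0 : ∀ X → InHle0 X → InHle0 (J X)
J-InHle0 X X∈ [] ()
J-InHle0 X X∈ (s ∷ v) s∷v>0 = trans (coeff-J s v X) (X∈ _ (raise-head s∷v>0))
  where
  raise-head : HasPositiveLetter (s ∷ v) → HasPositiveLetter ((s ℤ.+ + 1) ∷ v)
  raise-head (here s>0)  = here (ℤP.<-≤-trans s>0 (ℤP.i≤i+j s (+ 1)))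
  raise-head (there v>0) = there v>0

proposition2p18 : ∀ (X Y : H) → InHle0 X → InHle0 Y → InHle0 (X ⧢ Y) × InHle0 (J X)
proposition2p18 X Y X∈ Y∈ = ⧢-InHle0 X Y X∈ Y∈ , J-InHle0 X X∈
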